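{- Suppose that the following statement (S) holds for all positive integers $n, r$: for every simple graph $G$ on $n$ vertices and every colouring $c$ of $E(G)$ with $n$ colours in which each colour class has size at least $r$, $G$ contains a cycle $C$ of length at most $\lceil n/r \rceil$ such that no two edges of $C$ sharing a vertex have the same colour. Then for all positive integers $n, r$, every simple digraph on $n$ vertices with minimum outdegree at least $r$ contains a directed cycle of length at most $\lceil n/r \rceil$.
   Context: A digraph $D$ is simple if for all vertices $u,v$ there is at most one arc from $u$ to $v$. A colour class is the set of edges receiving a given colour. -}

module Defs where

open import Data.Nat using (ℕ; zero; suc; _+_; _≤_)
open import Data.Nat.DivMod using (_/_; _%_; m%n<n)
open import Data.Fin using (Fin; toℕ; fromℕ<; _<_)
open import Data.Bool using (Bool; true; false)
open import Data.Product using (Σ; _×_; _,_; ∃-syntax)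
open import Function.Definitions using (Injective)
open import Relation.Binary.PropositionalEquality using (_≡_; _≢_)

-- Ceiling division ⌈ n / r ⌉ (only used for r ≥ 1; value 0 at r = 0 is a dummy).
⌈_/_⌉ : ℕ → ℕ → ℕ
⌈ n / zero ⌉ = 0
⌈ n / suc r ⌉ = (n + r) / suc r

next : ∀ {m} → Fin (suc m) → Fin (suc m)
next {m} i = fromℕ< (m%n<n (suc (toℕ i)) (suc m))

record SimpleGraph (n : ℕ) : Set where
  field
    adj     : Fin n → Fin n → Bool
    sym     : ∀ u v → adj u v ≡ adj v u
    irrefl  : ∀ u → adj u u ≡ false
open SimpleGraph public

-- An edge colouring with colours Fin k: a colour assigned to each
-- unordered pair {u,v} (symmetric); values on non-edges are irrelevant.
record EdgeColouring {n : ℕ} (G : SimpleGraph n) (k : ℕ) : Set where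
  field
    col    : Fin n → Fin n → Fin k
    colSym : ∀ u v → col u v ≡ col v u
open EdgeColouring public

-- Edges of G, each represented once as (u , v) with u < v.
IsEdge : ∀ {n} → SimpleGraph n → Fin n × Fin n → Set
IsEdge G (u , v) = (u < v) × (adj G u v ≡ true)

ClassAtLeast : ∀ {n k} (G : SimpleGraph n) → EdgeColouring G k → Fin k → ℕ → Set
ClassAtLeast {n} G c a r =
  Σ (Fin r → Fin n × Fin n) λ f →
    Injective _≡_ _≡_ f ×
    (∀ i → IsEdge G (f i) × (col c (Data.Product.proj₁ (f i)) (Data.Product.proj₂ (f i)) ≡ a))

-- A cycle of length (suc m) in G: distinct vertices v 0, …, v m, with
-- v i adjacent to v (i+1 mod (m+1)); a cycle has length at least 3.
record Cycle {n : ℕ} (G : SimpleGraph n) (m : ℕ) : Set where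
  field
    len≥3  : 3 ≤ suc m
    vert   : Fin (suc m) → Fin n
    inj    : Injective _≡_ _≡_ vert
    edges  : ∀ i → adj G (vert i) (vert (next i)) ≡ true
open Cycle public

-- No two edges of the cycle sharing a vertex have the same colour
-- (in a cycle of length ≥ 3, edges sharing a vertex are exactly the
-- consecutive ones: {v i, v (i+1)} and {v (i+1), v (i+2)}).
ProperlyColoured : ∀ {n k m} {G : SimpleGraph n} → EdgeColouring G k → Cycle G m → Set
ProperlyColoured c C =
  ∀ i → col c (vert C i) (vert C (next i)) ≢ col c (vert C (next i)) (vert C (next (next i)))

StatementS : ℕ → ℕ → Set
StatementS n r =
  (G : SimpleGraph n) (c : EdgeColouring G n) →
  (∀ a → ClassAtLeast G c a r) →
  ∃[ m ] Σ (Cycle G m) λ C → (suc m ≤ ⌈ n / r ⌉) × ProperlyColoured c C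

record SimpleDigraph (n : ℕ) : Set where
  field
    arc       : Fin n → Fin n → Bool
    loopless  : ∀ u → arc u u ≡ false
open SimpleDigraph public

OutDegAtLeast : ∀ {n} → SimpleDigraph n → Fin n → ℕ → Set
OutDegAtLeast {n} D u r =
  Σ (Fin r → Fin n) λ f → Injective _≡_ _≡_ f × (∀ i → arc D u (f i) ≡ true)

MinOutDegAtLeast : ∀ {n} → SimpleDigraph n → ℕ → Set
MinOutDegAtLeast D r = ∀ u → OutDegAtLeast D u r

record DiCycle {n : ℕ} (D : SimpleDigraph n) (m : ℕ) : Set where
  field
    len≥2  : 2 ≤ suc m
    dvert  : Fin (suc m) → Fin n
    dinj   : Injective _≡_ _≡_ dvert
    arcs   : ∀ i → arc D (dvert i) (dvert (next i)) ≡ true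
open DiCycle public

StatementCH : ℕ → ℕ → Set
StatementCH n r =
  (D : SimpleDigraph n) → MinOutDegAtLeast D r →
  ∃[ m ] Σ (DiCycle D m) λ C → suc m ≤ ⌈ n / r ⌉

module Submission where

-- Let D be a simple digraph on n vertices with minimum outdegree r ≥ 1.
-- * If D has a 2-cycle u → w → u we are done: every vertex has r
--   out-neighbours other than itself, so r < n and hence 2 ≤ ⌈ n / r ⌉.
-- * Otherwise D is oriented.  Let G be its underlying graph and colour
--   each edge by the tail of the arc it comes from.  Colour class u then
--   contains the r arcs leaving u, so (S) yields a properly coloured cycle
--   C of length at most ⌈ n / r ⌉.  If an edge of C is traversed against
--   its arc, so is the next one (otherwise both would have the shared
--   vertex as tail, i.e. the same colour).  Going around C, either every
--   edge is traversed along its arc, or every edge is traversed against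
--   it; in the latter case C read backwards is a directed cycle.

open import Defs hiding (sym)
open import Data.Nat using (ℕ; zero; suc; _+_; _∸_; _*_; _≤_; _<_; z≤n; s≤s; _%_; _/_)
open import Data.Nat.Properties using
  (+-identityʳ; +-suc; +-∸-assoc; m+[n∸m]≡n; ≤-trans; <⇒≤; m≤n+m; n∸n≡0;
   m≤n⇒m<n∨m≡n; +-monoˡ-≤; ∸-monoʳ-<)
open import Data.Nat.DivMod using
  (m%n<n; n%n≡0; m%n%n≡m%n; [m+n]%n≡m%n; m<n⇒m%n≡m; %-distribˡ-+; m*n/n≡m; /-monoˡ-≤)
open import Data.Fin as Fin using (Fin; toℕ; opposite)
open import Data.Fin.Properties using
  (toℕ-injective; toℕ-fromℕ<; toℕ<n; toℕ≤pred[n]; <-cmp; any?; all?; ¬∀⟶∃¬; injective⇒≤;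
   punchOut-injective; opposite-prop; opposite-involutive)
open import Data.Bool using (true; false; if_then_else_; _∨_)
open import Data.Bool.Properties using (∨-comm) renaming (_≟_ to _≟B_)
open import Data.Product using (Σ; _×_; _,_; proj₁; proj₂; ∃-syntax)
open import Data.Sum using (_⊎_; inj₁; inj₂)
open import Data.Empty using (⊥-elim)
open import Relation.Nullary using (¬_; yes; no)
open import Relation.Nullary.Decidable using (_×-dec_)
open import Relation.Binary using (tri<; tri≈; tri>)
open import Relation.Binary.PropositionalEquality
open import Function.Definitions using (Injective)

toℕ-next : ∀ {m} (i : Fin (suc m)) → toℕ (next i) ≡ suc (toℕ i) % suc m
toℕ-next {m} i = toℕ-fromℕ< (m%n<n (suc (toℕ i)) (suc m))

toℕ-next-< : ∀ {m} (i : Fin (suc m)) → toℕ i < m → toℕ (next i) ≡ suc (toℕ i)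
toℕ-next-< i i<m = trans (toℕ-next i) (m<n⇒m%n≡m (s≤s i<m))

toℕ-next-last : ∀ {m} (i : Fin (suc m)) → toℕ i ≡ m → toℕ (next i) ≡ 0
toℕ-next-last {m} i i≡m = begin
  toℕ (next i)          ≡⟨ toℕ-next i ⟩
  suc (toℕ i) % suc m   ≡⟨ cong (λ t → suc t % suc m) i≡m ⟩
  suc m % suc m         ≡⟨ n%n≡0 (suc m) ⟩
  0                     ∎
  where open ≡-Reasoning

-- This is what makes a cycle read backwards again a cycle.
next-opposite : ∀ {m} (i : Fin (suc m)) → next (opposite (next i)) ≡ opposite i
next-opposite {m} i = toℕ-injective (mirror (m≤n⇒m<n∨m≡n (toℕ≤pred[n] i)))
  where
  open ≡-Reasoning
  mirror : toℕ i < m ⊎ toℕ i ≡ m → toℕ (next (opposite (next i))) ≡ toℕ (opposite i)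
  mirror (inj₁ i<m) = begin
    toℕ (next (opposite (next i))) ≡⟨ toℕ-next-< _ (subst (_< m) (sym opp≡) (∸-monoʳ-< (s≤s z≤n) i<m)) ⟩
    suc (toℕ (opposite (next i)))  ≡⟨ cong suc opp≡ ⟩
    suc (m ∸ suc (toℕ i))          ≡⟨ sym (+-∸-assoc 1 i<m) ⟩
    m ∸ toℕ i                      ≡⟨ sym (opposite-prop i) ⟩
    toℕ (opposite i)               ∎
    where
    opp≡ : toℕ (opposite (next i)) ≡ m ∸ suc (toℕ i)
    opp≡ = trans (opposite-prop (next i)) (cong (m ∸_) (toℕ-next-< i i<m))
  mirror (inj₂ i≡m) = begin
    toℕ (next (opposite (next i))) ≡⟨ toℕ-next-last _ opp≡ ⟩
    0                              ≡⟨ sym (n∸n≡0 m) ⟩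
    m ∸ m                          ≡⟨ cong (m ∸_) (sym i≡m) ⟩
    m ∸ toℕ i                      ≡⟨ sym (opposite-prop i) ⟩
    toℕ (opposite i)               ∎
    where
    opp≡ : toℕ (opposite (next i)) ≡ m
    opp≡ = trans (opposite-prop (next i)) (cong (m ∸_) (toℕ-next-last i i≡m))

opposite-injective : ∀ {m} → Injective _≡_ _≡_ (opposite {m})
opposite-injective {m} {x} {y} eq =
  trans (sym (opposite-involutive x)) (trans (cong opposite eq) (opposite-involutive y))

iterate : ∀ {m} → ℕ → Fin (suc m) → Fin (suc m)
iterate zero    i = i
iterate (suc k) i = next (iterate k i)

suc-%-idem : ∀ a d → suc (a % suc d) % suc d ≡ suc a % suc d
suc-%-idem a d = begin
  (1 + a % suc d) % suc d                  ≡⟨ %-distribˡ-+ 1 (a % suc d) (suc d) ⟩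
  (1 % suc d + a % suc d % suc d) % suc d  ≡⟨ cong (λ x → (1 % suc d + x) % suc d) (m%n%n≡m%n a (suc d)) ⟩
  (1 % suc d + a % suc d) % suc d          ≡⟨ sym (%-distribˡ-+ 1 a (suc d)) ⟩
  suc a % suc d                            ∎
  where open ≡-Reasoning

toℕ-iterate : ∀ {m} k (i : Fin (suc m)) → toℕ (iterate k i) ≡ (toℕ i + k) % suc m
toℕ-iterate {m} zero i =
  sym (trans (cong (_% suc m) (+-identityʳ (toℕ i))) (m<n⇒m%n≡m (toℕ<n i)))
toℕ-iterate {m} (suc k) i = begin
  toℕ (next (iterate k i))           ≡⟨ toℕ-next (iterate k i) ⟩
  suc (toℕ (iterate k i)) % suc m    ≡⟨ cong (λ x → suc x % suc m) (toℕ-iterate k i) ⟩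
  suc ((toℕ i + k) % suc m) % suc m  ≡⟨ suc-%-idem (toℕ i + k) m ⟩
  suc (toℕ i + k) % suc m            ≡⟨ cong (_% suc m) (sym (+-suc (toℕ i) k)) ⟩
  (toℕ i + suc k) % suc m            ∎
  where open ≡-Reasoning

iterate-surjective : ∀ {m} (i j : Fin (suc m)) → Σ ℕ λ k → iterate k i ≡ j
iterate-surjective {m} i j = k , toℕ-injective (begin
  toℕ (iterate k i)        ≡⟨ toℕ-iterate k i ⟩
  (toℕ i + k) % suc m      ≡⟨ cong (_% suc m) (m+[n∸m]≡n i≤j+len) ⟩
  (toℕ j + suc m) % suc m  ≡⟨ [m+n]%n≡m%n (toℕ j) (suc m) ⟩
  toℕ j % suc m            ≡⟨ m<n⇒m%n≡m (toℕ<n j) ⟩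
  toℕ j                    ∎)
  where
  open ≡-Reasoning
  k : ℕ
  k = (toℕ j + suc m) ∸ toℕ i
  i≤j+len : toℕ i ≤ toℕ j + suc m
  i≤j+len = ≤-trans (<⇒≤ (toℕ<n i)) (m≤n+m (suc m) (toℕ j))

cyclic-induction : ∀ {m} (P : Fin (suc m) → Set) → (∀ i → P i → P (next i)) →
                   ∀ i₀ → P i₀ → ∀ j → P j
cyclic-induction P step i₀ p j with iterate-surjective i₀ j
... | k , refl = along k
  where
  along : ∀ k → P (iterate k i₀)
  along zero    = p
  along (suc k) = step _ (along k)

-- A vertex with r distinct out-neighbours (none equal to itself, as D is
-- loopless) forces r < n.
outdegree<order : ∀ {n r} (D : SimpleDigraph n) (u : Fin n) →
                  OutDegAtLeast D u r → r < n
outdegree<order {suc n} D u (f , f-inj , f-arc) =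
  s≤s (injective⇒≤ (λ eq → f-inj (punchOut-injective (u≢f _) (u≢f _) eq)))
  where
  u≢f : ∀ i → u ≢ f i
  u≢f i refl with () ← trans (sym (f-arc i)) (loopless D u)

-- If r + 1 < n then ⌈ n / (r + 1) ⌉ = ⌊ (n + r) / (r + 1) ⌋ ≥ ⌊ 2(r + 1) / (r + 1) ⌋ = 2.
two≤⌈/⌉ : ∀ n r → suc r < n → 2 ≤ ⌈ n / suc r ⌉
two≤⌈/⌉ n r r<n = subst (_≤ (n + r) / suc r) (m*n/n≡m 2 (suc r)) (/-monoˡ-≤ (suc r) 2r≤n+r)
  where
  2r≡ : 2 * suc r ≡ suc (suc r) + r
  2r≡ = cong suc (trans (cong (r +_) (+-identityʳ (suc r))) (+-suc r r))
  2r≤n+r : 2 * suc r ≤ n + r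
  2r≤n+r = subst (_≤ n + r) (sym 2r≡) (+-monoˡ-≤ r r<n)

twoCycle : ∀ {n} (D : SimpleDigraph n) u w →
           arc D u w ≡ true → arc D w u ≡ true → DiCycle D 1
twoCycle {n} D u w uw wu = record
  { len≥2 = s≤s (s≤s z≤n) ; dvert = vertex ; dinj = vertex-inj
  ; arcs = λ { Fin.zero → uw ; (Fin.suc Fin.zero) → wu } }
  where
  vertex : Fin 2 → Fin n
  vertex Fin.zero    = u
  vertex (Fin.suc _) = w
  u≢w : u ≢ w
  u≢w refl with () ← trans (sym uw) (loopless D u)
  vertex-inj : Injective _≡_ _≡_ vertex
  vertex-inj {Fin.zero}          {Fin.zero}          _  = refl
  vertex-inj {Fin.zero}          {Fin.suc Fin.zero}  eq = ⊥-elim (u≢w eq)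
  vertex-inj {Fin.suc Fin.zero}  {Fin.zero}          eq = ⊥-elim (u≢w (sym eq))
  vertex-inj {Fin.suc Fin.zero}  {Fin.suc Fin.zero}  _  = refl

Oriented : ∀ {n} → SimpleDigraph n → Set
Oriented D = ∀ u v → arc D u v ≡ true → arc D v u ≡ false

∨-true : ∀ a b → a ∨ b ≡ true → a ≡ true ⊎ b ≡ true
∨-true true  b _  = inj₁ refl
∨-true false b ab = inj₂ ab

module TailColouring {n : ℕ} (D : SimpleDigraph (suc n)) (oriented : Oriented D) where

  -- The vertices, which also serve as the colours.
  V : Set
  V = Fin (suc n)

  G : SimpleGraph (suc n)
  G = record
    { adj    = λ u v → arc D u v ∨ arc D v u
    ; sym    = λ u v → ∨-comm (arc D u v) (arc D v u)
    ; irrefl = λ u → subst (λ b → b ∨ b ≡ false) (sym (loopless D u)) refl }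

  -- The colour of an edge is the tail of its arc (non-edges get colour 0).
  tail : V → V → V
  tail u v = if arc D u v then u else (if arc D v u then v else Fin.zero)

  tail-forward : ∀ u v → arc D u v ≡ true → tail u v ≡ u
  tail-forward u v uv rewrite uv = refl

  tail-backward : ∀ u v → arc D v u ≡ true → tail u v ≡ v
  tail-backward u v vu rewrite oriented v u vu | vu = refl

  -- Symmetry of the colouring uses orientation: at most one of u → v, v → u.
  tail-sym : ∀ u v → tail u v ≡ tail v u
  tail-sym u v with arc D u v in uv | arc D v u in vu
  ... | true  | true  with () ← trans (sym (oriented u v uv)) vu
  ... | true  | false = refl
  ... | false | true  = refl
  ... | false | false = refl

  c : EdgeColouring G (suc n)
  c = record { col = tail ; colSym = tail-sym }

  sortPair : V → V → V × V
  sortPair u w with <-cmp u w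
  ... | tri< _ _ _ = u , w
  ... | tri≈ _ _ _ = u , w
  ... | tri> _ _ _ = w , u

  sortPair-injective : ∀ u a b → sortPair u a ≡ sortPair u b → a ≡ b
  sortPair-injective u a b eq with <-cmp u a | <-cmp u b
  ... | tri< _ _ _ | tri< _ _ _ = cong proj₂ eq
  ... | tri< _ _ _ | tri≈ _ _ _ = cong proj₂ eq
  ... | tri< _ _ _ | tri> _ _ _ = trans (cong proj₂ eq) (cong proj₁ eq)
  ... | tri≈ _ _ _ | tri< _ _ _ = cong proj₂ eq
  ... | tri≈ _ _ _ | tri≈ _ _ _ = cong proj₂ eq
  ... | tri≈ _ _ _ | tri> _ _ _ = trans (cong proj₂ eq) (cong proj₁ eq)
  ... | tri> _ _ _ | tri< _ _ _ = trans (cong proj₁ eq) (cong proj₂ eq)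
  ... | tri> _ _ _ | tri≈ _ _ _ = trans (cong proj₁ eq) (cong proj₂ eq)
  ... | tri> _ _ _ | tri> _ _ _ = cong proj₁ eq

  arc⇒edge : ∀ u w → arc D u w ≡ true →
    IsEdge G (sortPair u w) × (tail (proj₁ (sortPair u w)) (proj₂ (sortPair u w)) ≡ u)
  arc⇒edge u w uw with <-cmp u w
  ... | tri< u<w _ _ = (u<w , subst (λ b → b ∨ arc D w u ≡ true) (sym uw) refl) , tail-forward u w uw
  ... | tri≈ _ refl _ with () ← trans (sym uw) (loopless D u)
  ... | tri> _ _ w<u = (w<u , trans (cong (arc D w u ∨_) uw) (∨-comm (arc D w u) true)) , tail-backward w u uw

  classes : ∀ {r} → MinOutDegAtLeast D r → ∀ a → ClassAtLeast G c a r
  classes outdeg a with outdeg a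
  ... | f , f-inj , f-arc = (λ i → sortPair a (f i))
                          , (λ eq → f-inj (sortPair-injective a _ _ eq))
                          , λ i → arc⇒edge a (f i) (f-arc i)

  module _ {m} (C : Cycle G m) (proper : ProperlyColoured c C) where

    private
      v : Fin (suc m) → V
      v = vert C

    Forward Backward : Fin (suc m) → Set
    Forward  i = arc D (v i) (v (next i)) ≡ true
    Backward i = arc D (v (next i)) (v i) ≡ true

    forward-or-backward : ∀ i → Forward i ⊎ Backward i
    forward-or-backward i = ∨-true _ _ (edges C i)

    -- Edge i against its arc and edge i+1 along its arc would both have
    -- colour v (i+1).
    backward-next : ∀ i → Backward i → Backward (next i)
    backward-next i back with forward-or-backward (next i)
    ... | inj₂ back′ = back′
    ... | inj₁ forw  = ⊥-elim (proper i (trans (tail-backward _ _ back)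
                                               (sym (tail-forward _ _ forw))))

    length≥2 : 2 ≤ suc m
    length≥2 with len≥3 C
    ... | s≤s (s≤s _) = s≤s (s≤s z≤n)

    directed : DiCycle D m
    directed with all? (λ i → arc D (v i) (v (next i)) ≟B true)
    ... | yes forward = record
      { len≥2 = length≥2 ; dvert = v ; dinj = inj C ; arcs = forward }
    ... | no notForward = record
      { len≥2 = length≥2 ; dvert = λ i → v (opposite i)
      ; dinj  = λ eq → opposite-injective (inj C eq)
      ; arcs  = λ i → subst (λ j → arc D (v j) (v (opposite (next i))) ≡ true)
                            (next-opposite i) (backward (opposite (next i))) }
      where
      backward : ∀ j → Backward j
      backward with ¬∀⟶∃¬ (suc m) _ (λ i → arc D (v i) (v (next i)) ≟B true) notForward
      ... | i₀ , ¬forw with forward-or-backward i₀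
      ...   | inj₁ forw = ⊥-elim (¬forw forw)
      ...   | inj₂ back = cyclic-induction Backward backward-next i₀ back

  shortDirectedCycle : ∀ {r} → StatementS (suc n) r → MinOutDegAtLeast D r →
                       ∃[ m ] Σ (DiCycle D m) λ C → suc m ≤ ⌈ suc n / r ⌉
  shortDirectedCycle S outdeg with S G c (classes outdeg)
  ... | m , C , short , proper = m , directed C proper , short

no2Cycle⇒oriented : ∀ {n} (D : SimpleDigraph n) →
  (∀ u w → ¬ (arc D u w ≡ true × arc D w u ≡ true)) → Oriented D
no2Cycle⇒oriented D no2Cycle u w uw with arc D w u in wu
... | true  = ⊥-elim (no2Cycle u w (uw , wu))
... | false = refl

mainTheorem2 : (∀ (n r : ℕ) → 1 ≤ n → 1 ≤ r → StatementS n r) →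
               ∀ (n r : ℕ) → 1 ≤ n → 1 ≤ r → StatementCH n r
mainTheorem2 S (suc n) (suc r) _ _ D outdeg
  with any? (λ u → any? (λ w → (arc D u w ≟B true) ×-dec (arc D w u ≟B true)))
... | yes (u , w , uw , wu) =
  1 , twoCycle D u w uw wu , two≤⌈/⌉ (suc n) r (outdegree<order D u (outdeg u))
... | no no2Cycle =
  TailColouring.shortDirectedCycle D oriented (S (suc n) (suc r) (s≤s z≤n) (s≤s z≤n)) outdeg
  where
  oriented : Oriented D
  oriented = no2Cycle⇒oriented D (λ u w uw∧wu → no2Cycle (u , w , uw∧wu))
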